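{- For any extrapolator $m:\mathcal{B}^*\to\{0,1\}$, the set of sequences in $\mathcal{C}$ NV-learnable by $m$ is a countably infinite dense subset of $\mathcal{C}$, while the set of sequences not NV-learnable by $m$ is a dense subset of $\mathcal{C}$ of cardinality $\mathfrak{c}$ (the cardinality of the continuum).
   Context: $\mathcal{B}=\{0,1\}$, $\mathcal{B}^*$ is the set of finite binary strings. $\mathcal{C}$ is the set of infinite binary sequences $\sigma=\sigma(1)\sigma(2)\dots$ with the product topology (basic open sets $B_w$ = sequences beginning with string $w$); $\sigma[n]$ is the string of the first $n$ bits. An extrapolator is any function $m:\mathcal{B}^*\to\{0,1\}$; $m$ NV-learns $\sigma$ if there is $N$ such that $m(\sigma[n])=\sigma(n+1)$ for all $n>N$. -}

module Defs where

open import Data.Bool using (Bool)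
open import Data.Nat using (ℕ; _<_)
open import Data.List using (List; length; applyUpTo)
open import Data.Product using (Σ; ∃; ∃-syntax; _×_)
open import Relation.Nullary using (¬_)
open import Relation.Binary.PropositionalEquality using (_≡_)

-- Finite binary strings B* : List Bool.
-- Infinite binary sequences C : ℕ → Bool, 0-indexed:
-- the paper's σ(k) (1-indexed) is our σ (k - 1).
Seq : Set
Seq = ℕ → Bool

Extrapolator : Set
Extrapolator = List Bool → Bool

prefix : Seq → ℕ → List Bool
prefix σ n = applyUpTo σ n

_≈_ : Seq → Seq → Set
σ ≈ τ = ∀ n → σ n ≡ τ n

-- m NV-learns σ : ∃ N, ∀ n > N, m(σ[n]) = σ(n+1)   (paper's 1-indexed σ(n+1) = our σ n)
NVLearns : Extrapolator → Seq → Set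
NVLearns m σ = ∃[ N ] (∀ n → N < n → m (prefix σ n) ≡ σ n)

-- P ⊆ C is dense: meets every basic open set B_w
Dense : (Seq → Set) → Set
Dense P = ∀ (w : List Bool) → ∃[ σ ] (prefix σ (length w) ≡ w × P σ)

CountablyInfinite : (Seq → Set) → Set
CountablyInfinite P =
  Σ (ℕ → Seq) λ f →
    (∀ k → P (f k)) ×
    (∀ i j → f i ≈ f j → i ≡ j) ×
    (∀ σ → P σ → ∃[ k ] (f k ≈ σ))

-- P ⊆ C has cardinality 𝔠 = |C|: an injection C → P (the inclusion P → C is
-- the injection in the other direction; Cantor–Schröder–Bernstein).
HasCardContinuum : (Seq → Set) → Set
HasCardContinuum P =
  Σ (Seq → Seq) λ g →
    (∀ τ → P (g τ)) ×
    (∀ τ τ' → g τ ≈ g τ' → τ ≈ τ')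

NotNVLearns : Extrapolator → Seq → Set
NotNVLearns m σ = ¬ NVLearns m σ

{-# OPTIONS --safe #-}
module Submission where

-- If m eventually predicts σ, then σ is determined by its prefix σ[k] up to
-- m's last mistake at k: from there on σ is forced to be the wrong bit and then
-- m's own predictions.  Conversely every string v, continued by the bit m does
-- not predict and then by m's predictions, is such a sequence.  So the learnable
-- sequences are parametrised by Maybe (List Bool), with nothing standing for
-- the sequence on which m never errs; this index set is countable.
-- Sequences that always contradict m from some point on are unlearnable; from
-- any prefix this gives density, and interleaving contrarian bits with an
-- arbitrary τ embeds C into the unlearnable sequences.

open import Defs
open import Data.Bool using (Bool; true; false; not; _≟_)
open import Data.Bool.Properties using (not-¬; ¬-not)
open import Data.List using (List; []; _∷_; _∷ʳ_; length)
open import Data.List.Properties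
  using (applyUpTo-∷ʳ; length-applyUpTo; length-++; ∷-injective; ∷ʳ-injective)
open import Data.Maybe using (Maybe; nothing; just)
open import Data.Maybe.Properties using (just-injective)
open import Data.Nat using (ℕ; zero; suc; _+_; _*_; _≤_; _<_; z≤n; s≤s; _<?_)
open import Data.Nat.Properties
  using ( ≤-refl; ≤-antisym; <⇒≤; ≮⇒≥; n≮0; m≤n⇒m<n∨m≡n
        ; m≤m+n; m≤n+m; m≤n*m; *-suc; +-comm)
open import Data.Nat.Binary as Bin using (ℕᵇ; 2[1+_]; 1+[2_]; fromℕ; toℕ)
open import Data.Nat.Binary.Properties using (fromℕ-toℕ; fromℕ-injective)
open import Data.Product using (∃-syntax; _×_; _,_; proj₁; proj₂)
open import Data.Sum using (_⊎_; inj₁; inj₂)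
open import Function using (_∘_)
open import Relation.Nullary using (yes; no)
open import Relation.Nullary.Negation using (contradiction)
open import Relation.Binary.PropositionalEquality
  using (_≡_; _≢_; refl; sym; trans; cong; cong₂; subst; module ≡-Reasoning)

open ≡-Reasoning

length-∷ʳ : ∀ {A : Set} (xs : List A) x → length (xs ∷ʳ x) ≡ suc (length xs)
length-∷ʳ xs x = trans (length-++ xs) (+-comm (length xs) 1)

prefix-suc : ∀ σ n → prefix σ (suc n) ≡ prefix σ n ∷ʳ σ n
prefix-suc σ n = sym (applyUpTo-∷ʳ σ n)

prefix-cong : ∀ {σ τ} → σ ≈ τ → ∀ n → prefix σ n ≡ prefix τ n
prefix-cong σ≈τ zero    = refl
prefix-cong σ≈τ (suc n) = cong₂ _∷_ (σ≈τ 0) (prefix-cong (σ≈τ ∘ suc) n)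

prefix-≡⇒≡ : ∀ σ τ {n i} → prefix σ n ≡ prefix τ n → i < n → σ i ≡ τ i
prefix-≡⇒≡ σ τ {suc n} {zero}  eq _         = proj₁ (∷-injective eq)
prefix-≡⇒≡ σ τ {suc n} {suc i} eq (s≤s i<n) =
  prefix-≡⇒≡ (σ ∘ suc) (τ ∘ suc) (proj₂ (∷-injective eq)) i<n

-- Each rule is pre-composed with the bits already emitted, so it always sees
-- the whole prefix of the sequence being built.
generate : Extrapolator → Seq
generate d zero    = d []
generate d (suc n) = generate (d ∘ (d [] ∷_)) n

continue : List Bool → Extrapolator → Seq
continue []      d n       = generate d n
continue (b ∷ w) d zero    = b
continue (b ∷ w) d (suc n) = continue w (d ∘ (b ∷_)) n

interleave : Seq → Extrapolator → Seq
interleave τ d zero          = d []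
interleave τ d (suc zero)    = τ 0
interleave τ d (suc (suc n)) = interleave (τ ∘ suc) (d ∘ (d [] ∷_) ∘ (τ 0 ∷_)) n

-- NVLearns m σ unfolds to ∃[ N ] PredictsFrom m (suc N) σ.
PredictsFrom : Extrapolator → ℕ → Seq → Set
PredictsFrom d K σ = ∀ n → K ≤ n → d (prefix σ n) ≡ σ n

MistakeAt : Extrapolator → Seq → ℕ → Set
MistakeAt d σ n = d (prefix σ n) ≢ σ n

generate-predicted : ∀ d → PredictsFrom d 0 (generate d)
generate-predicted d zero    _ = refl
generate-predicted d (suc n) _ = generate-predicted (d ∘ (d [] ∷_)) n z≤n

continue-prefix : ∀ w d → prefix (continue w d) (length w) ≡ w
continue-prefix []      d = refl
continue-prefix (b ∷ w) d = cong (b ∷_) (continue-prefix w (d ∘ (b ∷_)))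

continue-predicted : ∀ w d → PredictsFrom d (length w) (continue w d)
continue-predicted []      d n       _         = generate-predicted d n z≤n
continue-predicted (b ∷ w) d (suc n) (s≤s w≤n) = continue-predicted w (d ∘ (b ∷_)) n w≤n

interleave-odd : ∀ τ d k → interleave τ d (suc (2 * k)) ≡ τ k
interleave-odd τ d zero    = refl
interleave-odd τ d (suc k) =
  trans (cong (interleave τ d ∘ suc) (*-suc 2 k)) (interleave-odd (τ ∘ suc) _ k)

interleave-even : ∀ τ d k → d (prefix (interleave τ d) (2 * k)) ≡ interleave τ d (2 * k)
interleave-even τ d zero    = refl
interleave-even τ d (suc k) =
  subst (λ n → d (prefix (interleave τ d) n) ≡ interleave τ d n)
        (sym (*-suc 2 k)) (interleave-even (τ ∘ suc) _ k)

interleave-injective : ∀ τ τ′ d → interleave τ d ≈ interleave τ′ d → τ ≈ τ′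
interleave-injective τ τ′ d eq k = begin
  τ k                           ≡⟨ interleave-odd τ d k ⟨
  interleave τ d (suc (2 * k))  ≡⟨ eq (suc (2 * k)) ⟩
  interleave τ′ d (suc (2 * k)) ≡⟨ interleave-odd τ′ d k ⟩
  τ′ k                          ∎

predictsFrom-unique : ∀ d {K σ τ} → prefix σ K ≡ prefix τ K →
                      PredictsFrom d K σ → PredictsFrom d K τ → σ ≈ τ
predictsFrom-unique d {K} {σ} {τ} agree dσ dτ n =
  prefix-≡⇒≡ σ τ (prefixes (suc n)) ≤-refl
  where
  prefixes : ∀ n → prefix σ n ≡ prefix τ n
  prefixes zero    = refl
  prefixes (suc n) = begin
    prefix σ (suc n)   ≡⟨ prefix-suc σ n ⟩
    prefix σ n ∷ʳ σ n  ≡⟨ cong₂ _∷ʳ_ (prefixes n) bit ⟩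
    prefix τ n ∷ʳ τ n  ≡⟨ prefix-suc τ n ⟨
    prefix τ (suc n)   ∎
    where
    bit : σ n ≡ τ n
    bit with n <? K
    ... | yes n<K = prefix-≡⇒≡ σ τ agree n<K
    ... | no  n≮K = begin
      σ n             ≡⟨ dσ n (≮⇒≥ n≮K) ⟨
      d (prefix σ n)  ≡⟨ cong d (prefixes n) ⟩
      d (prefix τ n)  ≡⟨ dτ n (≮⇒≥ n≮K) ⟩
      τ n             ∎

mistake<predictionStart : ∀ d {K σ τ p} → σ ≈ τ →
                          PredictsFrom d K σ → MistakeAt d τ p → p < K
mistake<predictionStart d {K} {σ} {τ} {p} σ≈τ dσ miss with p <? K
... | yes p<K = p<K
... | no  p≮K = contradiction hit miss
  where
  hit : d (prefix τ p) ≡ τ p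
  hit = begin
    d (prefix τ p)  ≡⟨ cong d (prefix-cong σ≈τ p) ⟨
    d (prefix σ p)  ≡⟨ dσ p (≮⇒≥ p≮K) ⟩
    σ p             ≡⟨ σ≈τ p ⟩
    τ p             ∎

last-mistake : ∀ d {σ} K → PredictsFrom d K σ →
               PredictsFrom d 0 σ ⊎ ∃[ k ] (MistakeAt d σ k × PredictsFrom d (suc k) σ)
last-mistake d zero    predicted = inj₁ predicted
last-mistake d {σ} (suc K) predicted with d (prefix σ K) ≟ σ K
... | no  miss = inj₂ (K , miss , predicted)
... | yes hit  = last-mistake d K extended
  where
  extended : PredictsFrom d K σ
  extended n K≤n with m≤n⇒m<n∨m≡n K≤n
  ... | inj₁ K<n  = predicted n K<n
  ... | inj₂ refl = hit

contrarian-mistake : ∀ d σ {n} → not (d (prefix σ n)) ≡ σ n → MistakeAt d σ n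
contrarian-mistake d σ {n} eq = subst (d (prefix σ n) ≢_) eq (not-¬ refl)

mistakes-unbounded⇒¬NVLearns : ∀ d {σ} → (∀ N → ∃[ n ] (N < n × MistakeAt d σ n)) →
                               NotNVLearns d σ
mistakes-unbounded⇒¬NVLearns d unbounded (N , predicted) with unbounded N
... | n , N<n , miss = miss (predicted n N<n)

module _ (m : Extrapolator) where

  learnable : Maybe (List Bool) → Seq
  learnable nothing  = generate m
  learnable (just v) = continue (v ∷ʳ not (m v)) m

  learnable-just-prefix : ∀ v →
                          prefix (learnable (just v)) (suc (length v)) ≡ v ∷ʳ not (m v)
  learnable-just-prefix v =
    subst (λ n → prefix (learnable (just v)) n ≡ v ∷ʳ not (m v))
          (length-∷ʳ v (not (m v))) (continue-prefix (v ∷ʳ not (m v)) m)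

  learnable-just-predicted : ∀ v → PredictsFrom m (suc (length v)) (learnable (just v))
  learnable-just-predicted v =
    subst (λ n → PredictsFrom m n (learnable (just v)))
          (length-∷ʳ v (not (m v))) (continue-predicted (v ∷ʳ not (m v)) m)

  learnable-just-mistake : ∀ v → prefix (learnable (just v)) (length v) ≡ v ×
                                 MistakeAt m (learnable (just v)) (length v)
  learnable-just-mistake v =
    prefix≡v , contrarian-mistake m σ (trans (cong (not ∘ m) prefix≡v) (sym bit≡))
    where
    σ : Seq
    σ = learnable (just v)
    split : prefix σ (length v) ≡ v × σ (length v) ≡ not (m v)
    split = ∷ʳ-injective (prefix σ (length v)) v
              (trans (sym (prefix-suc σ (length v))) (learnable-just-prefix v))
    prefix≡v : prefix σ (length v) ≡ v
    prefix≡v = proj₁ split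
    bit≡ : σ (length v) ≡ not (m v)
    bit≡ = proj₂ split

  learnable-learns : ∀ x → NVLearns m (learnable x)
  learnable-learns nothing  = 0 , λ n _ → generate-predicted m n z≤n
  learnable-learns (just v) = length v , learnable-just-predicted v

  learnable-injective : ∀ x y → learnable x ≈ learnable y → x ≡ y
  learnable-injective nothing  nothing  _  = refl
  learnable-injective nothing  (just w) eq =
    contradiction (mistake<predictionStart m eq (generate-predicted m)
                                           (proj₂ (learnable-just-mistake w))) n≮0
  learnable-injective (just v) nothing  eq =
    contradiction (mistake<predictionStart m (sym ∘ eq) (generate-predicted m)
                                           (proj₂ (learnable-just-mistake v))) n≮0
  learnable-injective (just v) (just w) eq = cong just (begin
    v                               ≡⟨ proj₁ (learnable-just-mistake v) ⟨
    prefix (learnable (just v)) |v| ≡⟨ prefix-cong eq |v| ⟩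
    prefix (learnable (just w)) |v| ≡⟨ cong (prefix (learnable (just w))) |v|≡|w| ⟩
    prefix (learnable (just w)) |w| ≡⟨ proj₁ (learnable-just-mistake w) ⟩
    w                               ∎)
    where
    |v| |w| : ℕ
    |v| = length v
    |w| = length w
    |v|≡|w| : |v| ≡ |w|
    |v|≡|w| with s≤s |v|≤|w| ← mistake<predictionStart m (sym ∘ eq) (learnable-just-predicted w)
                                    (proj₂ (learnable-just-mistake v))
               | s≤s |w|≤|v| ← mistake<predictionStart m eq (learnable-just-predicted v)
                                    (proj₂ (learnable-just-mistake w))
               = ≤-antisym |v|≤|w| |w|≤|v|

  last-mistake-determines : ∀ σ k → MistakeAt m σ k → PredictsFrom m (suc k) σ →
                            learnable (just (prefix σ k)) ≈ σ
  last-mistake-determines σ k miss predicted =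
    predictsFrom-unique m same-prefix learnable-predicted predicted
    where
    v : List Bool
    v = prefix σ k
    |v|≡k : length v ≡ k
    |v|≡k = length-applyUpTo σ k
    learnable-predicted : PredictsFrom m (suc k) (learnable (just v))
    learnable-predicted = subst (λ n → PredictsFrom m (suc n) (learnable (just v)))
                                |v|≡k (learnable-just-predicted v)
    same-prefix : prefix (learnable (just v)) (suc k) ≡ prefix σ (suc k)
    same-prefix = begin
      prefix (learnable (just v)) (suc k)          ≡⟨ cong (prefix (learnable (just v)) ∘ suc) |v|≡k ⟨
      prefix (learnable (just v)) (suc (length v)) ≡⟨ learnable-just-prefix v ⟩
      v ∷ʳ not (m v)                               ≡⟨ cong (v ∷ʳ_) (¬-not (miss ∘ sym)) ⟨
      v ∷ʳ σ k                                     ≡⟨ prefix-suc σ k ⟨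
      prefix σ (suc k)                             ∎

  learnable-surjective : ∀ σ → NVLearns m σ → ∃[ x ] (learnable x ≈ σ)
  learnable-surjective σ (N , predicted) with last-mistake m (suc N) predicted
  ... | inj₁ never-wrong =
    nothing , predictsFrom-unique m refl (generate-predicted m) never-wrong
  ... | inj₂ (k , miss , predicted′) =
    just (prefix σ k) , last-mistake-determines σ k miss predicted′

  NVLearns-dense : Dense (NVLearns m)
  NVLearns-dense w =
    continue w m , continue-prefix w m ,
    length w , λ n w<n → continue-predicted w m n (<⇒≤ w<n)

  NotNVLearns-dense : Dense (NotNVLearns m)
  NotNVLearns-dense w = continue w (not ∘ m) , continue-prefix w (not ∘ m) ,
    mistakes-unbounded⇒¬NVLearns m λ N →
      suc N + length w , s≤s (m≤m+n N (length w)) ,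
      contrarian-mistake m (continue w (not ∘ m))
        (continue-predicted w (not ∘ m) _ (m≤n+m (length w) (suc N)))

  interleave-contrarian-unlearnable : ∀ τ → NotNVLearns m (interleave τ (not ∘ m))
  interleave-contrarian-unlearnable τ = mistakes-unbounded⇒¬NVLearns m λ N →
    2 * suc N , m≤n*m (suc N) 2 ,
    contrarian-mistake m (interleave τ (not ∘ m)) (interleave-even τ (not ∘ m) (suc N))

-- ℕᵇ is bijective base-2 numeration, so its digits are exactly the bits of a string.
bits : ℕᵇ → List Bool
bits Bin.zero   = []
bits 2[1+ x ]   = true ∷ bits x
bits 1+[2 x ]   = false ∷ bits x

fromBits : List Bool → ℕᵇ
fromBits []          = Bin.zero
fromBits (true ∷ v)  = 2[1+ fromBits v ]
fromBits (false ∷ v) = 1+[2 fromBits v ]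

fromBits-bits : ∀ x → fromBits (bits x) ≡ x
fromBits-bits Bin.zero = refl
fromBits-bits 2[1+ x ] = cong 2[1+_] (fromBits-bits x)
fromBits-bits 1+[2 x ] = cong 1+[2_] (fromBits-bits x)

bits-fromBits : ∀ v → bits (fromBits v) ≡ v
bits-fromBits []          = refl
bits-fromBits (true ∷ v)  = cong (true ∷_) (bits-fromBits v)
bits-fromBits (false ∷ v) = cong (false ∷_) (bits-fromBits v)

decode : ℕ → Maybe (List Bool)
decode zero    = nothing
decode (suc n) = just (bits (fromℕ n))

decode-injective : ∀ i j → decode i ≡ decode j → i ≡ j
decode-injective zero    zero    _  = refl
decode-injective (suc i) (suc j) eq = cong suc (fromℕ-injective (begin
  fromℕ i                    ≡⟨ fromBits-bits (fromℕ i) ⟨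
  fromBits (bits (fromℕ i))  ≡⟨ cong fromBits (just-injective eq) ⟩
  fromBits (bits (fromℕ j))  ≡⟨ fromBits-bits (fromℕ j) ⟩
  fromℕ j                    ∎))

decode-surjective : ∀ x → ∃[ n ] (decode n ≡ x)
decode-surjective nothing  = zero , refl
decode-surjective (just v) = suc (toℕ (fromBits v)) , cong just (begin
  bits (fromℕ (toℕ (fromBits v))) ≡⟨ cong bits (fromℕ-toℕ (fromBits v)) ⟩
  bits (fromBits v)               ≡⟨ bits-fromBits v ⟩
  v                               ∎)

proposition2 : (m : Extrapolator) →
    (CountablyInfinite (NVLearns m) × Dense (NVLearns m)) ×
    (Dense (NotNVLearns m) × HasCardContinuum (NotNVLearns m))
proposition2 m =
  ((learnable m ∘ decode , learnable-learns m ∘ decode , enumeration-injective , enumeration-onto)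
  , NVLearns-dense m)
  , (NotNVLearns-dense m
  , (λ τ → interleave τ (not ∘ m))
  , interleave-contrarian-unlearnable m
  , (λ τ τ′ → interleave-injective τ τ′ (not ∘ m)))
  where
  enumeration-injective : ∀ i j → learnable m (decode i) ≈ learnable m (decode j) → i ≡ j
  enumeration-injective i j = decode-injective i j ∘ learnable-injective m (decode i) (decode j)

  enumeration-onto : ∀ σ → NVLearns m σ → ∃[ k ] (learnable m (decode k) ≈ σ)
  enumeration-onto σ learned with learnable-surjective m σ learned
  ... | x , x≈σ with decode-surjective x
  ... | k , refl = k , x≈σ
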